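{- Let $\mathcal{A}$ be a finite totally ordered alphabet and let $\overline{w}$ be a decreasing word over $\mathcal{A}$. Let $\mathcal{L}_{\overline{w}}$ be the set of decreasing words $w$ over $\mathcal{A}$ with $w >_{\mathrm{lex}} \overline{w}$. Then the number of minimal words of $\mathcal{L}_{\overline{w}}$ is exactly $\#\mathcal{A}$.
   Context: A word over $\mathcal{A}$ is a finite sequence of letters; $\epsilon$ denotes the empty word. The lexicographical order $<_{\mathrm{lex}}$ on words: for $w_1=a_0\cdots a_p$ and $w_2=b_0\cdots b_q$, $w_1<_{\mathrm{lex}}w_2$ iff either there is $k\le\min(p,q)$ with $a_i=b_i$ for all $i<k$ and $a_k<b_k$, or $w_1$ is a proper prefix of $w_2$ (in particular $\epsilon<_{\mathrm{lex}} w$ for every nonempty $w$). A word $a_0\cdots a_m$ is decreasing if $a_i\ge a_{i+1}$ for all $0\le i\le m-1$ (the empty word is decreasing). The suffix-cut operator $SC(w)$ removes the last letter of $w$ if $w\ne\epsilon$, and $SC(\epsilon)=\epsilon$. A word $w$ is a minimal word of $\mathcal{L}_{\overline{w}}$ if $w\in\mathcal{L}_{\overline{w}}$ but $SC(w)\notin\mathcal{L}_{\overline{w}}$. -}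

module Defs where

open import Data.Nat using (ℕ)
open import Data.Fin using (Fin; _<_; _≥_)
open import Data.List using (List; []; _∷_; length)
open import Data.List.Relation.Unary.Linked using (Linked)
open import Data.List.Relation.Unary.Unique.Propositional using (Unique)
open import Data.List.Membership.Propositional using (_∈_)
open import Data.Product using (_×_; ∃)
open import Relation.Nullary using (¬_)
open import Function.Bundles using (_⇔_)
open import Relation.Binary.PropositionalEquality using (_≡_)

-- The finite totally ordered alphabet is modelled as Fin n with its usual order
-- (every finite total order of size n is order-isomorphic to Fin n).
Word : ℕ → Set
Word n = List (Fin n)

data _<lex_ {n : ℕ} : Word n → Word n → Set where
  ε<   : ∀ {b v} → [] <lex (b ∷ v)
  head< : ∀ {a b u v} → a < b → (a ∷ u) <lex (b ∷ v)
  tail< : ∀ {a u v} → u <lex v → (a ∷ u) <lex (a ∷ v)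

Decreasing : ∀ {n} → Word n → Set
Decreasing = Linked _≥_

SC : ∀ {n} → Word n → Word n
SC []           = []
SC (a ∷ [])     = []
SC (a ∷ b ∷ w)  = a ∷ SC (b ∷ w)

L : ∀ {n} → Word n → Word n → Set
L wbar w = Decreasing w × (wbar <lex w)

Minimal : ∀ {n} → Word n → Word n → Set
Minimal wbar w = L wbar w × ¬ L wbar (SC w)

HasCardinality : ∀ {n} → (Word n → Set) → ℕ → Set
HasCardinality {n} P k =
  ∃ λ (ws : List (Word n)) → Unique ws × (∀ w → (w ∈ ws) ⇔ P w) × (length ws ≡ k)

-- A minimal word of L_w̄ is determined by its last letter c: it is the longest
-- prefix of w̄ all of whose letters are ≥ c, followed by c.  Conversely each of
-- these words is decreasing, exceeds w̄, and drops to ≤ w̄ when its last letter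
-- is cut, so the minimal words are in bijection with the alphabet.
module Submission where

open import Defs
open import Data.Nat using (ℕ)
import Data.Nat.Properties as ℕ
open import Data.Fin using (Fin; _≤_)
open import Data.Fin.Properties using (_≤?_; ≤-refl; ≤-trans; <-irrefl)
open import Data.List using (List; []; _∷_; map; allFin; length; last)
open import Data.List.Properties using (length-map; length-tabulate)
open import Data.List.Relation.Unary.All as All using (All; []; _∷_)
open import Data.List.Relation.Unary.Linked using ([]; [-]; _∷_)
open import Data.List.Relation.Unary.Unique.Propositional using (Unique)
open import Data.List.Relation.Unary.Unique.Propositional.Properties using (map⁺; allFin⁺)
open import Data.List.Membership.Propositional using (_∈_)
open import Data.List.Membership.Propositional.Properties using (∈-map⁺; ∈-map⁻; ∈-allFin)
open import Data.Maybe using (just)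
open import Data.Maybe.Properties using (just-injective)
open import Data.Product using (∃-syntax; _,_; proj₂)
open import Data.Empty using (⊥-elim)
open import Function using (_∘_)
open import Function.Bundles using (_⇔_; mk⇔)
open import Relation.Nullary using (¬_; yes; no)
open import Relation.Binary.PropositionalEquality
  using (_≡_; refl; sym; trans; cong; subst; module ≡-Reasoning)

private
  variable
    n : ℕ

SC-decreasing : (w : Word n) → Decreasing w → Decreasing (SC w)
SC-decreasing []              _       = []
SC-decreasing (_ ∷ [])        _       = []
SC-decreasing (_ ∷ _ ∷ [])    _       = [-]
SC-decreasing (_ ∷ b ∷ c ∷ w) (r ∷ d) = r ∷ SC-decreasing (b ∷ c ∷ w) d

¬<lex-SC-∷ : ∀ {u w : Word n} a → ¬ u <lex SC w → ¬ (a ∷ u) <lex SC (a ∷ w)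
¬<lex-SC-∷ {w = []}    a _    ()
¬<lex-SC-∷ {w = _ ∷ _} a _    (head< a<a) = <-irrefl refl a<a
¬<lex-SC-∷ {w = _ ∷ _} a u≮w (tail< u<w)  = u≮w u<w

minimalWord : Word n → Fin n → Word n
minimalWord []       c = c ∷ []
minimalWord (b ∷ bs) c with c ≤? b
... | yes _ = b ∷ minimalWord bs c
... | no  _ = c ∷ []

minimalWords : Word n → List (Word n)
minimalWords {n} wbar = map (minimalWord wbar) (allFin n)

minimalWord-∷-≤ : ∀ {b c : Fin n} bs → c ≤ b → minimalWord (b ∷ bs) c ≡ b ∷ minimalWord bs c
minimalWord-∷-≤ {b = b} {c} bs c≤b with c ≤? b
... | yes _   = refl
... | no  c≰b = ⊥-elim (c≰b c≤b)

minimalWord-∷-≰ : ∀ {b c : Fin n} bs → ¬ c ≤ b → minimalWord (b ∷ bs) c ≡ c ∷ []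
minimalWord-∷-≰ {b = b} {c} bs c≰b with c ≤? b
... | yes c≤b = ⊥-elim (c≰b c≤b)
... | no  _   = refl

minimalWord-≥ : (u : Word n) (c : Fin n) → All (c ≤_) (minimalWord u c)
minimalWord-≥ []       c = ≤-refl ∷ []
minimalWord-≥ (b ∷ bs) c with c ≤? b
... | yes c≤b = c≤b ∷ minimalWord-≥ bs c
... | no  _   = ≤-refl ∷ []

last-minimalWord : (u : Word n) (c : Fin n) → last (minimalWord u c) ≡ just c
last-minimalWord []       c = refl
last-minimalWord (b ∷ bs) c with c ≤? b
... | no  _ = refl
... | yes _ with minimalWord bs c | last-minimalWord bs c
...   | _ ∷ _ | last≡c = last≡c

minimalWord-injective : (u : Word n) {c c′ : Fin n} → minimalWord u c ≡ minimalWord u c′ → c ≡ c′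
minimalWord-injective u {c} {c′} eq = just-injective (begin
  just c                   ≡⟨ sym (last-minimalWord u c) ⟩
  last (minimalWord u c)   ≡⟨ cong last eq ⟩
  last (minimalWord u c′)  ≡⟨ last-minimalWord u c′ ⟩
  just c′                  ∎)
  where open ≡-Reasoning

minimalWord-decreasing-∷ : ∀ {x c : Fin n} (bs : Word n) → c ≤ x →
                           Decreasing (x ∷ bs) → Decreasing (x ∷ minimalWord bs c)
minimalWord-decreasing-∷         []       c≤x _ = c≤x ∷ [-]
minimalWord-decreasing-∷ {c = c} (b ∷ bs) c≤x (b≤x ∷ d) with c ≤? b
... | yes c≤b = b≤x ∷ minimalWord-decreasing-∷ bs c≤b d
... | no  _   = c≤x ∷ [-]

minimalWord-decreasing : (wbar : Word n) (c : Fin n) → Decreasing wbar → Decreasing (minimalWord wbar c)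
minimalWord-decreasing []       c _ = [-]
minimalWord-decreasing (b ∷ bs) c d with c ≤? b
... | yes c≤b = minimalWord-decreasing-∷ bs c≤b d
... | no  _   = [-]

<lex-minimalWord : (wbar : Word n) (c : Fin n) → wbar <lex minimalWord wbar c
<lex-minimalWord []       c = ε<
<lex-minimalWord (b ∷ bs) c with c ≤? b
... | yes _   = tail< (<lex-minimalWord bs c)
... | no  c≰b = head< (ℕ.≰⇒> c≰b)

¬<lex-SC-minimalWord : (wbar : Word n) (c : Fin n) → ¬ wbar <lex SC (minimalWord wbar c)
¬<lex-SC-minimalWord []       c ()
¬<lex-SC-minimalWord (b ∷ bs) c with c ≤? b
... | yes _ = ¬<lex-SC-∷ b (¬<lex-SC-minimalWord bs c)
... | no  _ = λ ()

minimalWord-minimal : (wbar : Word n) (c : Fin n) → Decreasing wbar → Minimal wbar (minimalWord wbar c)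
minimalWord-minimal wbar c d =
  (minimalWord-decreasing wbar c d , <lex-minimalWord wbar c) , ¬<lex-SC-minimalWord wbar c ∘ proj₂

≡minimalWord : (wbar w : Word n) → Decreasing w → wbar <lex w → ¬ wbar <lex SC w →
               ∃[ c ] w ≡ minimalWord wbar c
≡minimalWord []      (b ∷ [])    _         ε<          _   = b , refl
≡minimalWord []      (_ ∷ _ ∷ _) _         ε<          w≯ = ⊥-elim (w≯ ε<)
≡minimalWord (_ ∷ u) (b ∷ [])    _         (head< a<b) _   = b , sym (minimalWord-∷-≰ u (ℕ.<⇒≱ a<b))
≡minimalWord (_ ∷ _) (_ ∷ _ ∷ _) _         (head< a<b) w≯ = ⊥-elim (w≯ (head< a<b))
≡minimalWord (_ ∷ _) (_ ∷ [])    _         (tail< ())  _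
≡minimalWord (a ∷ u) (a ∷ x ∷ v) (x≤a ∷ d) (tail< u<v) w≯
  with ≡minimalWord u (x ∷ v) d u<v (w≯ ∘ tail<)
... | c , v≡ = c , trans (cong (a ∷_) v≡) (sym (minimalWord-∷-≤ u (≤-trans c≤x x≤a)))
  where
  c≤x : c ≤ x
  c≤x = All.head (subst (All (c ≤_)) (sym v≡) (minimalWord-≥ u c))

Minimal⇒∈minimalWords : (wbar w : Word n) → Minimal wbar w → w ∈ minimalWords wbar
Minimal⇒∈minimalWords wbar w ((d , wbar<w) , ¬L-SC)
  with ≡minimalWord wbar w d wbar<w (λ wbar<SC → ¬L-SC (SC-decreasing w d , wbar<SC))
... | c , refl = ∈-map⁺ (minimalWord wbar) (∈-allFin c)

∈minimalWords⇔Minimal : (wbar : Word n) → Decreasing wbar →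
                        ∀ w → (w ∈ minimalWords wbar) ⇔ Minimal wbar w
∈minimalWords⇔Minimal wbar d w = mk⇔ ∈⇒Minimal (Minimal⇒∈minimalWords wbar w)
  where
  ∈⇒Minimal : w ∈ minimalWords wbar → Minimal wbar w
  ∈⇒Minimal w∈ with ∈-map⁻ (minimalWord wbar) w∈
  ... | c , _ , refl = minimalWord-minimal wbar c d

minimalWords-unique : (wbar : Word n) → Unique (minimalWords wbar)
minimalWords-unique {n} wbar = map⁺ (minimalWord-injective wbar) (allFin⁺ n)

length-minimalWords : (wbar : Word n) → length (minimalWords wbar) ≡ n
length-minimalWords {n} wbar =
  trans (length-map (minimalWord wbar) (allFin n)) (length-tabulate (λ i → i))

proposition2p3 : (n : ℕ) (wbar : Word n) → Decreasing wbar →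
                   HasCardinality (Minimal wbar) n
proposition2p3 n wbar d =
  minimalWords wbar , minimalWords-unique wbar , ∈minimalWords⇔Minimal wbar d , length-minimalWords wbar
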